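{- For any set $S \subseteq V$ and any subset $T \subseteq S$ of conflicting nodes, the inequality $\sum_{a \in \delta^-(S) \cap \grave{A}^{ - }_{T}} y_a \geq \sum_{i\in T} z_i$ is valid for $\mathcal{P}$.
   Context: Let $G=(V,A)$ be a DAG with $V=\{1,\dots,n\}$ and $\check{A}\subseteq A$. Let $\bar{G}=(\bar V,\bar A)$ with $\bar V=\{0\}\cup V\cup\{\bar n\}$, $\bar n=n+1$, and $\bar A=\{(0,i):i\in V\}\cup A\cup\{(i,\bar n):i\in V\}$. For $S\subseteq\bar V$, $\delta^+(S)$ (resp. $\delta^-(S)$) denotes the arcs of $\bar A$ leaving (resp. entering) $S$. A path $(0,v_1,\dots,v_h,\bar n)$ in $\bar G$ is feasible if it traverses at least one arc of $\check{A}$, and infeasible otherwise. $\mathcal{P}$ is the convex hull of all binary vectors $y\in\{0,1\}^{|\bar A|}$ satisfying $\sum_{a\in\delta^-(i)}y_a\le 1$ and $\sum_{a\in\delta^-(i)}y_a=\sum_{a\in\delta^+(i)}y_a$ for all $i\in V$, and $\sum_{i=0}^h y_{(v_i,v_{i+1})}\le h$ for every infeasible path $(v_0=0,v_1,\dots,v_h,v_{h+1}=\bar n)$. For $i\in V$, $z_i=\sum_{a\in\delta^-(i)}y_a$. Two nodes are conflicting if no path in $\bar G$ passes through both; a set of conflicting nodes is a set of pairwise conflicting nodes. For each $i\in V$, $\grave{A}^{ - }_{i}$ is the set of arcs of all partial paths of the form $(0,\ldots,i)$ that are part of a feasible path from $0$ to $\bar n$; $\grave{A}^{ - }_{T}=\bigcup_{i\in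 T}\grave{A}^{ - }_{i}$.
   Formalization: The inequality is checked only at points of $\mathcal{P}$ with rational coordinates, written as convex combinations of the binary vectors with rational coefficients. -}

module Defs where

open import Data.Bool using (Bool; true; false; T; T?)
open import Data.Nat using (ℕ; zero; suc)
open import Data.Fin using (Fin)
import Data.Fin as Fin
open import Data.Fin.Subset using (Subset; _∈_; _∉_)
open import Data.Fin.Subset.Properties using (_∈?_)
open import Data.Integer using (+_)
open import Data.List using (List; []; _∷_; _++_; [_]; length; map)
open import Data.List.Relation.Unary.All using (All)
open import Data.List.Relation.Unary.Any using (Any)
import Data.List.Membership.Propositional as LM
open import Data.Product using (Σ; ∃; _×_; _,_; proj₁; proj₂)
open import Data.Sum using (_⊎_)
open import Data.Empty using (⊥)
open import Data.Unit using (⊤)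
open import Data.Rational using (ℚ; 0ℚ; 1ℚ; _+_; _*_; _≤_; _/_)
open import Relation.Nullary using (¬_; yes; no; Dec)
open import Relation.Binary.PropositionalEquality using (_≡_)

-- The graph G = (V, A) with V = {1..n} represented as Fin n,
-- A given by a Boolean adjacency matrix, Ǎ ⊆ A likewise.

-- Walks inside G (between inner nodes).  In a DAG every walk is a path.
data Walk {n : ℕ} (A : Fin n → Fin n → Bool) : Fin n → Fin n → Set where
  stop : ∀ v → Walk A v v
  step : ∀ u {w v} → T (A u w) → Walk A w v → Walk A u v

record Graph : Set where
  field
    n      : ℕ
    A      : Fin n → Fin n → Bool
    Ac     : Fin n → Fin n → Bool
    Ac⊆A   : ∀ i j → T (Ac i j) → T (A i j)
    acyclic : ∀ i j → T (A i j) → ¬ Walk A j i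

module _ (G : Graph) where
  open Graph G

  -- Arcs of Ḡ: (0,i), arcs of A, and (i, n̄).
  data Arc : Set where
    src : Fin n → Arc
    mid : (i j : Fin n) → T (A i j) → Arc
    snk : Fin n → Arc

  walkArcs : ∀ {u v} → Walk A u v → List Arc
  walkArcs (stop v) = []
  walkArcs (step u {w} p r) = mid u w p ∷ walkArcs r

  _++ʷ_ : ∀ {u v w} → Walk A u v → Walk A v w → Walk A u w
  stop _ ++ʷ r = r
  step u p q ++ʷ r = step u p (q ++ʷ r)

  -- a path (0, v1, ..., vh, n̄) of Ḡ: first inner node u, last inner node v
  record Path : Set where
    constructor path
    field
      first last : Fin n
      body : Walk A first last

  pathArcs : Path → List Arc
  pathArcs (path u v w) = src u ∷ walkArcs w ++ [ snk v ]

  walkNodes : ∀ {u v} → Walk A u v → List (Fin n)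
  walkNodes (stop v) = v ∷ []
  walkNodes (step u _ r) = u ∷ walkNodes r

  pathNodes : Path → List (Fin n)
  pathNodes (path u v w) = walkNodes w

  Checked : Arc → Set
  Checked (mid i j _) = T (Ac i j)
  Checked _ = ⊥

  Feasible : Path → Set
  Feasible p = Any Checked (pathArcs p)

  Infeasible : Path → Set
  Infeasible p = ¬ Feasible p

  Conflicting : Fin n → Fin n → Set
  Conflicting i j = ¬ (Σ Path λ p → (i LM.∈ pathNodes p) × (j LM.∈ pathNodes p))

  ConflictingSet : Subset n → Set
  ConflictingSet T' = ∀ i j → i ∈ T' → j ∈ T' → ¬ i ≡ j → Conflicting i j

  -- a ∈ À⁻ᵢ : a is an arc of a partial path (0,...,i) that is the prefix
  -- of a feasible path (0,...,i,...,n̄)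
  InÀ : Fin n → Arc → Set
  InÀ i a = Σ (Fin n) λ u → Σ (Fin n) λ v →
            Σ (Walk A u i) λ w₁ → Σ (Walk A i v) λ w₂ →
            Feasible (path u v (w₁ ++ʷ w₂)) × (a LM.∈ (src u ∷ walkArcs w₁))

  InÀT : Subset n → Arc → Set
  InÀT T' a = Σ (Fin n) λ i → (i ∈ T') × InÀ i a

  Enters : Subset n → Arc → Set
  Enters S (src i) = i ∈ S
  Enters S (mid j i _) = (j ∉ S) × (i ∈ S)
  Enters S (snk _) = ⊥

  ΣFin : ∀ {m} → (Fin m → ℚ) → ℚ
  ΣFin {zero} f = 0ℚ
  ΣFin {suc m} f = f Fin.zero + ΣFin (λ k → f (Fin.suc k))

  sumℚ : List ℚ → ℚ
  sumℚ [] = 0ℚ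
  sumℚ (x ∷ xs) = x + sumℚ xs

  valMid : (Arc → ℚ) → Fin n → Fin n → ℚ
  valMid y i j with T? (A i j)
  ... | yes p = y (mid i j p)
  ... | no _ = 0ℚ

  inflow : (Arc → ℚ) → Fin n → ℚ
  inflow y i = y (src i) + ΣFin (λ j → valMid y j i)

  outflow : (Arc → ℚ) → Fin n → ℚ
  outflow y i = y (snk i) + ΣFin (λ j → valMid y i j)

  z : (Arc → ℚ) → Fin n → ℚ
  z = inflow

  ΣT : Subset n → (Fin n → ℚ) → ℚ
  ΣT T' f = ΣFin (λ i → sel (i ∈? T') (f i))
    where
      sel : ∀ {P : Set} → Dec P → ℚ → ℚ
      sel (yes _) q = q
      sel (no _) _ = 0ℚ

  record IntPoint (y : Arc → ℚ) : Set where
    field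
      binary   : ∀ a → (y a ≡ 0ℚ) ⊎ (y a ≡ 1ℚ)
      degree   : ∀ i → inflow y i ≤ 1ℚ
      flow     : ∀ i → inflow y i ≡ outflow y i
      infeasib : ∀ (p : Path) → Infeasible p →
                 sumℚ (map y (pathArcs p)) + 1ℚ ≤ (+ length (pathArcs p)) / 1

  InP : (Arc → ℚ) → Set
  InP y = Σ (List (ℚ × (Arc → ℚ))) λ cs →
            All (λ c → (0ℚ ≤ proj₁ c) × IntPoint (proj₂ c)) cs
          × (sumℚ (map proj₁ cs) ≡ 1ℚ)
          × (∀ a → y a ≡ sumℚ (map (λ c → proj₁ c * proj₂ c a) cs))

{-# OPTIONS --safe #-}

-- At an integer point y of 𝒫 the arcs with y_a = 1 form node-disjoint paths from 0 to n̄
-- (in-degree at most 1, flow conservation, acyclicity), and each of them is feasible, since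
-- on an infeasible path the constraint would be violated.  If i ∈ T has z_i = 1, the path
-- through i starts outside S and reaches i ∈ S, so it enters S at an arc a ∈ δ⁻(S) ∩ À⁻_i with
-- y_a = 1, from which it runs on to i.  Two nodes of T never get the same arc: both would lie
-- on the unique path leaving it, but T is conflicting.  So Σ_{i∈T} z_i counts distinct arcs a
-- of δ⁻(S) ∩ À⁻_T with y_a = 1.  Both sides are linear in y, so the inequality passes from
-- the integer points to their convex combinations.

module Submission where

open import Defs
open import Algebra.Bundles using (CommutativeMonoid)
open import Data.Bool using (T; T?)
open import Data.Bool.Properties using (T-irrelevant)
open import Data.Fin using (Fin; zero; suc)
open import Data.Fin.Properties using (injective⇒≤; ¬∀⟶∃¬; suc-injective) renaming (_≟_ to _≟ᶠ_)
open import Data.Fin.Subset using (Subset; Side; inside; _⊆_) renaming (_∈_ to _∈ˢ_; _∉_ to _∉ˢ_)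
open import Data.Fin.Subset.Properties using (_∈?_)
import Data.Integer as ℤ
import Data.Integer.Properties as ℤP
open import Data.List using (List; []; _∷_; _++_; length; map; lookup)
open import Data.List.Membership.Propositional using (_∈_)
open import Data.List.Membership.Propositional.Properties using (∈-lookup)
open import Data.List.Relation.Unary.All as All using (All; []; _∷_)
import Data.List.Relation.Unary.All.Properties as AllP
open import Data.List.Relation.Unary.AllPairs using ([]; _∷_)
open import Data.List.Relation.Unary.Any using (here; there; any?; index)
open import Data.List.Relation.Unary.Any.Properties using (lookup-index)
open import Data.List.Relation.Unary.Unique.Propositional using (Unique)
open import Data.Nat as ℕ using (ℕ; zero; suc)
import Data.Nat.Coprimality as Coprimality
import Data.Nat.Properties as ℕP
open import Data.Product using (Σ; _×_; _,_; proj₁; proj₂)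
import Data.Rational as ℚ
open import Data.Rational using (ℚ; 0ℚ; 1ℚ; _+_; _*_; _/_; _≤_; nonNegative)
import Data.Rational.Properties as ℚP
open import Data.Sum as Sum using (_⊎_; inj₁; inj₂; [_,_])
open import Data.Vec using (Vec; _[_]=_)
open import Function using (_∘_; id)
open import Function.Bundles using (_⇔_; Equivalence)
open import Relation.Binary.PropositionalEquality
  using (_≡_; _≢_; refl; sym; trans; cong; cong₂; subst; module ≡-Reasoning)
open import Relation.Nullary using (¬_; Dec; yes; no; contradiction)
open import Relation.Nullary.Decidable using (toWitness; toWitnessFalse)

open import Algebra.Properties.CommutativeSemigroup
  (CommutativeMonoid.commutativeSemigroup ℚP.+-0-commutativeMonoid) using (interchange)
open import Algebra.Properties.CommutativeMonoid.Sum ℚP.+-0-commutativeMonoid using (sum; ∑-distrib-+)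

0≤1 : 0ℚ ≤ 1ℚ
0≤1 = toWitness {a? = 0ℚ ℚP.≤? 1ℚ} _

0≢1 : 0ℚ ≢ 1ℚ
0≢1 = toWitnessFalse {a? = 0ℚ ℚP.≟ 1ℚ} _

p+1≰p : ∀ p → ¬ (p + 1ℚ ≤ p)
p+1≰p p p+1≤p = ℚP.<-irrefl refl (ℚP.<-≤-trans p<p+1 p+1≤p)
  where
  p<p+1 : p ℚ.< p + 1ℚ
  p<p+1 = subst (ℚ._< p + 1ℚ) (ℚP.+-identityʳ p) (ℚP.+-monoʳ-< p (toWitness {a? = 0ℚ ℚP.<? 1ℚ} _))

p≤p+q : ∀ {p q} → 0ℚ ≤ q → p ≤ p + q
p≤p+q {p} {q} 0≤q = subst (_≤ p + q) (ℚP.+-identityʳ p) (ℚP.+-monoʳ-≤ p 0≤q)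

q≤p+q : ∀ {p q} → 0ℚ ≤ p → q ≤ p + q
q≤p+q {p} {q} 0≤p = subst (_≤ p + q) (ℚP.+-identityˡ q) (ℚP.+-monoˡ-≤ q 0≤p)

binary⇒nonneg : ∀ {q} → q ≡ 0ℚ ⊎ q ≡ 1ℚ → 0ℚ ≤ q
binary⇒nonneg (inj₁ refl) = ℚP.≤-refl
binary⇒nonneg (inj₂ refl) = 0≤1

1+n/1≡[1+n]/1 : ∀ k → 1ℚ + (ℤ.+ k) / 1 ≡ (ℤ.+ suc k) / 1
1+n/1≡[1+n]/1 k =
  trans (cong (λ t → 1ℚ + t) (ℚP.normalize-coprime {k} {0} (Coprimality.sym (Coprimality.1-coprimeTo k))))
        (cong (λ t → (ℤ.+ 1 ℤ.+ t) / 1) (ℤP.*-identityʳ (ℤ.+ k)))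

select : ∀ {P : Set} → Dec P → ℚ → ℚ
select (yes _) q = q
select (no _)  _ = 0ℚ

select-yes : ∀ {P : Set} (d : Dec P) {q} → P → select d q ≡ q
select-yes (yes _) _ = refl
select-yes (no ¬p) p = contradiction p ¬p

select-no : ∀ {P : Set} (d : Dec P) {q} → ¬ P → select d q ≡ 0ℚ
select-no (yes p) ¬p = contradiction p ¬p
select-no (no _)  _  = refl

select-binary : ∀ {P : Set} (d : Dec P) {q} → q ≡ 0ℚ ⊎ q ≡ 1ℚ → select d q ≡ 0ℚ ⊎ select d q ≡ 1ℚ
select-binary (yes _) q01 = q01
select-binary (no _)  _   = inj₁ refl

select≡1 : ∀ {P : Set} (d : Dec P) {q} → select d q ≡ 1ℚ → P × q ≡ 1ℚ
select≡1 (yes p) q≡1 = p , q≡1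
select≡1 (no _)  0≡1 = contradiction 0≡1 0≢1

-- Finite sums

module FiniteSums (G : Graph) where

  ΣFin-cong : ∀ {m} {f g : Fin m → ℚ} → (∀ i → f i ≡ g i) → ΣFin G f ≡ ΣFin G g
  ΣFin-cong {zero}  f≗g = refl
  ΣFin-cong {suc m} f≗g = cong₂ _+_ (f≗g zero) (ΣFin-cong (f≗g ∘ suc))

  ΣFin-mono : ∀ {m} {f g : Fin m → ℚ} → (∀ i → f i ≤ g i) → ΣFin G f ≤ ΣFin G g
  ΣFin-mono {zero}  f≤g = ℚP.≤-refl
  ΣFin-mono {suc m} f≤g = ℚP.+-mono-≤ (f≤g zero) (ΣFin-mono (f≤g ∘ suc))

  ΣFin-zero : ∀ {m} {f : Fin m → ℚ} → (∀ i → f i ≡ 0ℚ) → ΣFin G f ≡ 0ℚ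
  ΣFin-zero {zero}  f≡0 = refl
  ΣFin-zero {suc m} f≡0 = cong₂ _+_ (f≡0 zero) (ΣFin-zero (f≡0 ∘ suc))

  ΣFin-nonneg : ∀ {m} {f : Fin m → ℚ} → (∀ i → 0ℚ ≤ f i) → 0ℚ ≤ ΣFin G f
  ΣFin-nonneg {m} {f} f≥0 = subst (_≤ ΣFin G f) (ΣFin-zero {m} (λ _ → refl)) (ΣFin-mono f≥0)

  ΣFin-single : ∀ {m} {f : Fin m → ℚ} j → (∀ i → i ≢ j → f i ≡ 0ℚ) → ΣFin G f ≡ f j
  ΣFin-single {suc m} {f} zero others≡0 =
    trans (cong (f zero +_) (ΣFin-zero (λ i → others≡0 (suc i) λ ()))) (ℚP.+-identityʳ (f zero))
  ΣFin-single {suc m} {f} (suc j) others≡0 =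
    trans (cong₂ _+_ (others≡0 zero λ ()) (ΣFin-single j (λ i i≢j → others≡0 (suc i) (i≢j ∘ suc-injective))))
          (ℚP.+-identityˡ (f (suc j)))

  term≤ΣFin : ∀ {m} {f : Fin m → ℚ} → (∀ i → 0ℚ ≤ f i) → ∀ j → f j ≤ ΣFin G f
  term≤ΣFin {suc m} f≥0 zero    = p≤p+q (ΣFin-nonneg (f≥0 ∘ suc))
  term≤ΣFin {suc m} f≥0 (suc j) = ℚP.≤-trans (term≤ΣFin (f≥0 ∘ suc) j) (q≤p+q (f≥0 zero))

  pair≤ΣFin : ∀ {m} {f : Fin m → ℚ} → (∀ i → 0ℚ ≤ f i) → ∀ {j k} → j ≢ k → f j + f k ≤ ΣFin G f
  pair≤ΣFin _ {zero} {zero} j≢k = contradiction refl j≢k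
  pair≤ΣFin {f = f} f≥0 {zero} {suc k} _ = ℚP.+-monoʳ-≤ (f zero) (term≤ΣFin (f≥0 ∘ suc) k)
  pair≤ΣFin {f = f} f≥0 {suc j} {zero} _ =
    subst (_≤ ΣFin G f) (ℚP.+-comm (f zero) (f (suc j))) (ℚP.+-monoʳ-≤ (f zero) (term≤ΣFin (f≥0 ∘ suc) j))
  pair≤ΣFin f≥0 {suc j} {suc k} j≢k =
    ℚP.≤-trans (pair≤ΣFin (f≥0 ∘ suc) (j≢k ∘ cong suc)) (q≤p+q (f≥0 zero))

  ΣFin≢0⇒term≢0 : ∀ {m} {f : Fin m → ℚ} → ΣFin G f ≢ 0ℚ → Σ (Fin m) λ j → f j ≢ 0ℚ
  ΣFin≢0⇒term≢0 {m} {f} Σ≢0 = ¬∀⟶∃¬ m (λ j → f j ≡ 0ℚ) (λ j → f j ℚP.≟ 0ℚ) (Σ≢0 ∘ ΣFin-zero)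

  ΣFin≡sum : ∀ {m} (f : Fin m → ℚ) → ΣFin G f ≡ sum f
  ΣFin≡sum {zero}  f = refl
  ΣFin≡sum {suc m} f = cong (f zero +_) (ΣFin≡sum (f ∘ suc))

  ΣFin-+ : ∀ {m} (f g : Fin m → ℚ) → ΣFin G (λ i → f i + g i) ≡ ΣFin G f + ΣFin G g
  ΣFin-+ f g = begin
    ΣFin G (λ i → f i + g i) ≡⟨ ΣFin≡sum (λ i → f i + g i) ⟩
    sum (λ i → f i + g i)    ≡⟨ ∑-distrib-+ f g ⟩
    sum f + sum g            ≡⟨ sym (cong₂ _+_ (ΣFin≡sum f) (ΣFin≡sum g)) ⟩
    ΣFin G f + ΣFin G g      ∎
    where open ≡-Reasoning

  ΣFin-comm : ∀ {m k} (w : Fin m → Fin k → ℚ) →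
              ΣFin G (λ i → ΣFin G (w i)) ≡ ΣFin G (λ j → ΣFin G (λ i → w i j))
  ΣFin-comm {zero} {k} w = sym (ΣFin-zero {k} (λ _ → refl))
  ΣFin-comm {suc m} w =
    trans (cong (ΣFin G (w zero) +_) (ΣFin-comm (w ∘ suc))) (sym (ΣFin-+ (w zero) _))

  sumℚ≡ΣFin-lookup : ∀ {X : Set} (g : X → ℚ) (xs : List X) → sumℚ G (map g xs) ≡ ΣFin G (g ∘ lookup xs)
  sumℚ≡ΣFin-lookup g []       = refl
  sumℚ≡ΣFin-lookup g (x ∷ xs) = cong (g x +_) (sumℚ≡ΣFin-lookup g xs)

  sumℚ-mono-All : ∀ {X : Set} {P : X → Set} {f g : X → ℚ} (xs : List X) → All P xs →
                  (∀ x → P x → f x ≤ g x) → sumℚ G (map f xs) ≤ sumℚ G (map g xs)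
  sumℚ-mono-All []       []         _   = ℚP.≤-refl
  sumℚ-mono-All (x ∷ xs) (px ∷ pxs) f≤g = ℚP.+-mono-≤ (f≤g x px) (sumℚ-mono-All xs pxs f≤g)

  ΣFin≤-of-at-most-one-1 :
    ∀ {m} {h : Fin m → ℚ} {b} → (∀ i → h i ≡ 0ℚ ⊎ h i ≡ 1ℚ) →
    (∀ {i i′} → h i ≡ 1ℚ → h i′ ≡ 1ℚ → i ≡ i′) → (∀ i → h i ≡ 1ℚ → 1ℚ ≤ b) → 0ℚ ≤ b →
    ΣFin G h ≤ b
  ΣFin≤-of-at-most-one-1 {zero} _ _ _ 0≤b = 0≤b
  ΣFin≤-of-at-most-one-1 {suc m} {h} {b} h-binary one-1 1≤b 0≤b with h-binary zero
  ... | inj₁ h₀≡0 =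
    subst (_≤ b) (sym (trans (cong (_+ ΣFin G (h ∘ suc)) h₀≡0) (ℚP.+-identityˡ _)))
      (ΣFin≤-of-at-most-one-1 (h-binary ∘ suc) (λ e e′ → suc-injective (one-1 e e′)) (1≤b ∘ suc) 0≤b)
  ... | inj₂ h₀≡1 =
    subst (_≤ b) (sym (trans (cong₂ _+_ h₀≡1 (ΣFin-zero rest≡0)) (ℚP.+-identityʳ 1ℚ))) (1≤b zero h₀≡1)
    where
    rest≡0 : ∀ i → h (suc i) ≡ 0ℚ
    rest≡0 i = [ id , (λ hᵢ≡1 → contradiction (one-1 h₀≡1 hᵢ≡1) λ ()) ] (h-binary (suc i))

  -- Double counting over the 0/1 matrix [c i = j], whose row i sums to f i and column j to
  -- at most g j.
  module _ {m k} {f : Fin m → ℚ} {g : Fin k → ℚ}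
           (f-binary : ∀ i → f i ≡ 0ℚ ⊎ f i ≡ 1ℚ) (g-nonneg : ∀ j → 0ℚ ≤ g j)
           (c : ∀ i → f i ≡ 1ℚ → Fin k) (g∘c≥1 : ∀ i e → 1ℚ ≤ g (c i e))
           (c-injective : ∀ {i i′} e e′ → c i e ≡ c i′ e′ → i ≡ i′) where

    private
      weight : ∀ i → Dec (f i ≡ 1ℚ) → Fin k → ℚ
      weight i (yes e) j = select (c i e ≟ᶠ j) 1ℚ
      weight i (no _)  j = 0ℚ

      weight-row : ∀ i d → ΣFin G (weight i d) ≡ f i
      weight-row i (yes e) =
        trans (ΣFin-single (c i e) (λ j j≢c → select-no (c i e ≟ᶠ j) (j≢c ∘ sym)))
              (trans (select-yes (c i e ≟ᶠ c i e) refl) (sym e))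
      weight-row i (no f≢1) = trans (ΣFin-zero {k} (λ _ → refl)) (sym ([ id , (λ e → contradiction e f≢1) ] (f-binary i)))

      weight-binary : ∀ i d j → weight i d j ≡ 0ℚ ⊎ weight i d j ≡ 1ℚ
      weight-binary i (yes e) j = select-binary (c i e ≟ᶠ j) (inj₂ refl)
      weight-binary i (no _)  j = inj₁ refl

      weight≡1 : ∀ i d j → weight i d j ≡ 1ℚ → Σ (f i ≡ 1ℚ) λ e → c i e ≡ j
      weight≡1 i (yes e) j w≡1 = e , proj₁ (select≡1 (c i e ≟ᶠ j) w≡1)
      weight≡1 i (no _)  j 0≡1 = contradiction 0≡1 0≢1

      w : Fin m → Fin k → ℚ
      w i = weight i (f i ℚP.≟ 1ℚ)

      w≡1 : ∀ {i j} → w i j ≡ 1ℚ → Σ (f i ≡ 1ℚ) λ e → c i e ≡ j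
      w≡1 {i} {j} = weight≡1 i (f i ℚP.≟ 1ℚ) j

      column≤ : ∀ j → ΣFin G (λ i → w i j) ≤ g j
      column≤ j = ΣFin≤-of-at-most-one-1 (λ i → weight-binary i (f i ℚP.≟ 1ℚ) j) one-1 1≤g (g-nonneg j)
        where
        one-1 : ∀ {i i′} → w i j ≡ 1ℚ → w i′ j ≡ 1ℚ → i ≡ i′
        one-1 wᵢ≡1 wᵢ′≡1 with w≡1 wᵢ≡1 | w≡1 wᵢ′≡1
        ... | e , c≡j | e′ , c′≡j = c-injective e e′ (trans c≡j (sym c′≡j))
        1≤g : ∀ i → w i j ≡ 1ℚ → 1ℚ ≤ g j
        1≤g i wᵢ≡1 with w≡1 wᵢ≡1
        ... | e , refl = g∘c≥1 i e

    ΣFin≤ΣFin-by-injection : ΣFin G f ≤ ΣFin G g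
    ΣFin≤ΣFin-by-injection = begin
      ΣFin G f                             ≡⟨ ΣFin-cong (λ i → sym (weight-row i (f i ℚP.≟ 1ℚ))) ⟩
      ΣFin G (λ i → ΣFin G (w i))          ≡⟨ ΣFin-comm w ⟩
      ΣFin G (λ j → ΣFin G (λ i → w i j))  ≤⟨ ΣFin-mono column≤ ⟩
      ΣFin G g                             ∎
      where open ℚP.≤-Reasoning

-- `ΣT` chooses its summands with a function local to its definition, which cannot be named
-- here.  Once `_[_]=_` and `_∈?_` are abstracted, the body of `ΣT-summand` can be solved by
-- unification as that function, and `select-by-answer` shows that it agrees with `select`,
-- since it can only depend on the yes/no answer of the decision procedure.

Membership : ℕ → Set₁
Membership n = Vec Side n → Fin n → Side → Set

Decider : ∀ n → Membership n → Set
Decider n R = (i : Fin n) (p : Vec Side n) → Dec (R p i inside)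

select-by-answer :
  ∀ {n} (T : Subset n) (i : Fin n) (x : ℚ) (K : (R : Membership n) → Decider n R → ℚ) →
  (∀ R dec → K R dec ≡ K (λ _ _ _ → R T i inside) (λ _ _ → dec i T)) →
  (∀ (P : Set) p → K (λ _ _ _ → P) (λ _ _ → yes p) ≡ x) →
  (∀ (P : Set) ¬p → K (λ _ _ _ → P) (λ _ _ → no ¬p) ≡ 0ℚ) →
  ∀ R dec → K R dec ≡ select (dec i T) x
select-by-answer T i x K local yes-case no-case R dec = trans (local R dec) (by-answer (dec i T))
  where
  by-answer : ∀ {P : Set} (d : Dec P) → K (λ _ _ _ → P) (λ _ _ → d) ≡ select d x
  by-answer (yes p) = yes-case _ p
  by-answer (no ¬p) = no-case _ ¬p

mutual
  private
    ΣT-summand : (G : Graph) (T : Subset (Graph.n G)) (f : Fin (Graph.n G) → ℚ)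
                 (R : Membership (Graph.n G)) → Decider (Graph.n G) R → Fin (Graph.n G) → ℚ
    ΣT-summand G T f R dec i = _

  ΣT≡ΣFin-select : (G : Graph) (T : Subset (Graph.n G)) (f : Fin (Graph.n G) → ℚ) →
                   ΣT G T f ≡ ΣFin G (λ i → select (i ∈? T) (f i))
  ΣT≡ΣFin-select G T f with _[_]=_ {A = Side} {Graph.n G} | _∈?_ {Graph.n G}
  ... | R | dec = FiniteSums.ΣFin-cong G {f = ΣT-summand G T f R dec} λ i →
    select-by-answer T i (f i) (λ R′ dec′ → ΣT-summand G T f R′ dec′ i)
      (λ _ _ → refl) (λ _ _ → refl) (λ _ _ → refl) R dec

-- Linear functionals and the polytope

module Linearity (G : Graph) where
  open Graph G
  open FiniteSums G

  record Linear (F : (Arc G → ℚ) → ℚ) : Set where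
    field
      F-cong : ∀ {y y′} → (∀ a → y a ≡ y′ a) → F y ≡ F y′
      F-0    : F (λ _ → 0ℚ) ≡ 0ℚ
      F-+    : ∀ y y′ → F (λ a → y a + y′ a) ≡ F y + F y′
      F-*    : ∀ c y → F (λ a → c * y a) ≡ c * F y
  open Linear

  linear-eval : ∀ a → Linear (λ y → y a)
  linear-eval a = record { F-cong = λ y≗y′ → y≗y′ a ; F-0 = refl ; F-+ = λ _ _ → refl ; F-* = λ _ _ → refl }

  linear-0 : Linear (λ _ → 0ℚ)
  linear-0 = record
    { F-cong = λ _ → refl
    ; F-0    = refl
    ; F-+    = λ _ _ → sym (ℚP.+-identityʳ 0ℚ)
    ; F-*    = λ c _ → sym (ℚP.*-zeroʳ c)
    }

  linear-+ : ∀ {F F′} → Linear F → Linear F′ → Linear (λ y → F y + F′ y)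
  linear-+ {F} {F′} l l′ = record
    { F-cong = λ y≗y′ → cong₂ _+_ (F-cong l y≗y′) (F-cong l′ y≗y′)
    ; F-0    = trans (cong₂ _+_ (F-0 l) (F-0 l′)) (ℚP.+-identityʳ 0ℚ)
    ; F-+    = λ y y′ → trans (cong₂ _+_ (F-+ l y y′) (F-+ l′ y y′)) (interchange (F y) (F y′) (F′ y) (F′ y′))
    ; F-*    = λ c y → trans (cong₂ _+_ (F-* l c y) (F-* l′ c y)) (sym (ℚP.*-distribˡ-+ c (F y) (F′ y)))
    }

  linear-ΣFin : ∀ {m} {F : Fin m → (Arc G → ℚ) → ℚ} → (∀ i → Linear (F i)) → Linear (λ y → ΣFin G (λ i → F i y))
  linear-ΣFin {zero}  _ = linear-0
  linear-ΣFin {suc m} l = linear-+ (l zero) (linear-ΣFin (l ∘ suc))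

  linear-select : ∀ {P : Set} (d : Dec P) {F} → Linear F → Linear (λ y → select d (F y))
  linear-select (yes _) l = l
  linear-select (no _)  _ = linear-0

  linear-valMid : ∀ i j → Linear (λ y → valMid G y i j)
  linear-valMid i j with T? (A i j)
  ... | yes p = linear-eval (mid i j p)
  ... | no _  = linear-0

  linear-z : ∀ i → Linear (λ y → z G y i)
  linear-z i = linear-+ (linear-eval (src i)) (linear-ΣFin (λ j → linear-valMid j i))

  linear-sumℚ : ∀ xs → Linear (λ y → sumℚ G (map y xs))
  linear-sumℚ []       = linear-0
  linear-sumℚ (a ∷ xs) = linear-+ (linear-eval a) (linear-sumℚ xs)

  F-combination :
    ∀ {F} → Linear F → (cs : List (ℚ × (Arc G → ℚ))) →
    F (λ a → sumℚ G (map (λ c → proj₁ c * proj₂ c a) cs)) ≡ sumℚ G (map (λ c → proj₁ c * F (proj₂ c)) cs)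
  F-combination l []       = F-0 l
  F-combination l (c ∷ cs) =
    trans (F-+ l (λ a → proj₁ c * proj₂ c a) (λ a → sumℚ G (map (λ c → proj₁ c * proj₂ c a) cs)))
          (cong₂ _+_ (F-* l (proj₁ c) (proj₂ c)) (F-combination l cs))

  valid-on-P : ∀ {F₁ F₂} → Linear F₁ → Linear F₂ →
               (∀ y → IntPoint G y → F₁ y ≤ F₂ y) → ∀ y → InP G y → F₁ y ≤ F₂ y
  valid-on-P {F₁} {F₂} l₁ l₂ valid-on-integers y (cs , vertices , _ , y≡Σcs) = begin
    F₁ y                                                    ≡⟨ F-cong l₁ y≡Σcs ⟩
    F₁ (λ a → sumℚ G (map (λ c → proj₁ c * proj₂ c a) cs))  ≡⟨ F-combination l₁ cs ⟩
    sumℚ G (map (λ c → proj₁ c * F₁ (proj₂ c)) cs)          ≤⟨ sumℚ-mono-All cs vertices scaled ⟩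
    sumℚ G (map (λ c → proj₁ c * F₂ (proj₂ c)) cs)          ≡⟨ sym (F-combination l₂ cs) ⟩
    F₂ (λ a → sumℚ G (map (λ c → proj₁ c * proj₂ c a) cs))  ≡⟨ sym (F-cong l₂ y≡Σcs) ⟩
    F₂ y                                                    ∎
    where
    open ℚP.≤-Reasoning
    scaled : ∀ c → (0ℚ ≤ proj₁ c) × IntPoint G (proj₂ c) → proj₁ c * F₁ (proj₂ c) ≤ proj₁ c * F₂ (proj₂ c)
    scaled (λc , yc) (0≤λc , yc-int) = ℚP.*-monoˡ-≤-nonNeg λc {{nonNegative 0≤λc}} (valid-on-integers yc yc-int)

-- Walks in a DAG

Unique⇒lookup-injective : ∀ {X : Set} {xs : List X} → Unique xs →
                          ∀ {i j} → lookup xs i ≡ lookup xs j → i ≡ j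
Unique⇒lookup-injective (_ ∷ _)    {zero}  {zero}  _ = refl
Unique⇒lookup-injective (x∉ ∷ _)   {zero}  {suc j} x≡ = contradiction x≡ (All.lookup x∉ (∈-lookup j))
Unique⇒lookup-injective (x∉ ∷ _)   {suc i} {zero}  ≡x = contradiction (sym ≡x) (All.lookup x∉ (∈-lookup i))
Unique⇒lookup-injective (_ ∷ uxs)  {suc i} {suc j} eq = cong suc (Unique⇒lookup-injective uxs eq)

Unique⇒length≤ : ∀ {m} {xs : List (Fin m)} → Unique xs → length xs ℕ.≤ m
Unique⇒length≤ uxs = injective⇒≤ (Unique⇒lookup-injective uxs)

module Walks (G : Graph) where
  open Graph G

  _++ᵂ_ : ∀ {u v x} → Walk A u v → Walk A v x → Walk A u x
  _++ᵂ_ = _++ʷ_ G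

  walkArcs-++ᵂ : ∀ {u v x} (w₁ : Walk A u v) (w₂ : Walk A v x) →
                 walkArcs G (w₁ ++ᵂ w₂) ≡ walkArcs G w₁ ++ walkArcs G w₂
  walkArcs-++ᵂ (stop _)     w₂ = refl
  walkArcs-++ᵂ (step u p w) w₂ = cong (mid u _ p ∷_) (walkArcs-++ᵂ w w₂)

  length-snoc : ∀ {u v x} (w : Walk A u v) (p : T (A v x)) →
                length (walkArcs G (w ++ᵂ step v p (stop x))) ≡ suc (length (walkArcs G w))
  length-snoc (stop _)     p = refl
  length-snoc (step u q w) p = cong suc (length-snoc w p)

  first∈walkNodes : ∀ {u v} (w : Walk A u v) → u ∈ walkNodes G w
  first∈walkNodes (stop _)     = here refl
  first∈walkNodes (step _ _ _) = here refl

  last∈walkNodes : ∀ {u v} (w : Walk A u v) → v ∈ walkNodes G w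
  last∈walkNodes (stop _)     = here refl
  last∈walkNodes (step _ _ w) = there (last∈walkNodes w)

  prefix : ∀ {u v x} (w : Walk A u v) → x ∈ walkNodes G w → Walk A u x
  prefix (stop _)     (here refl) = stop _
  prefix (step u _ _) (here refl) = stop u
  prefix (step u p w) (there x∈) = step u p (prefix w x∈)

  walkNodes-unique : ∀ {u v} (w : Walk A u v) → Unique (walkNodes G w)
  walkNodes-unique (stop _)         = [] ∷ []
  walkNodes-unique (step u {x} p w) =
    All.tabulate (λ u′∈ u≡u′ → acyclic u x p (prefix w (subst (_∈ walkNodes G w) (sym u≡u′) u′∈)))
    ∷ walkNodes-unique w

  length-walkNodes : ∀ {u v} (w : Walk A u v) → length (walkNodes G w) ≡ suc (length (walkArcs G w))
  length-walkNodes (stop _)     = refl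
  length-walkNodes (step _ _ w) = cong suc (length-walkNodes w)

  walk-length< : ∀ {u v} (w : Walk A u v) → length (walkArcs G w) ℕ.< n
  walk-length< w = subst (ℕ._≤ n) (length-walkNodes w) (Unique⇒length≤ (walkNodes-unique w))

-- Integer points of 𝒫

module IntegerPoint (G : Graph) {y : Arc G → ℚ} (y-int : IntPoint G y) where
  open Graph G
  open IntPoint y-int
  open FiniteSums G
  open Walks G

  y-nonneg : ∀ a → 0ℚ ≤ y a
  y-nonneg a = binary⇒nonneg (binary a)

  valMid-arc : ∀ i j (p : T (A i j)) → valMid G y i j ≡ y (mid i j p)
  valMid-arc i j p with T? (A i j)
  ... | yes p′ = cong (y ∘ mid i j) (T-irrelevant p′ p)
  ... | no ¬p  = contradiction p ¬p

  valMid-nonneg : ∀ i j → 0ℚ ≤ valMid G y i j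
  valMid-nonneg i j with T? (A i j)
  ... | yes p = y-nonneg (mid i j p)
  ... | no _  = ℚP.≤-refl

  valMid≢0 : ∀ i j → valMid G y i j ≢ 0ℚ → Σ (T (A i j)) λ p → y (mid i j p) ≡ 1ℚ
  valMid≢0 i j v≢0 with T? (A i j)
  ... | no _  = contradiction refl v≢0
  ... | yes p = p , [ (λ y≡0 → contradiction y≡0 v≢0) , id ] (binary (mid i j p))

  one-or-term≢0 : ∀ {x m} {f : Fin m → ℚ} → x ≡ 0ℚ ⊎ x ≡ 1ℚ → x + ΣFin G f ≢ 0ℚ →
                  x ≡ 1ℚ ⊎ Σ (Fin m) λ j → f j ≢ 0ℚ
  one-or-term≢0 (inj₂ x≡1) _   = inj₁ x≡1
  one-or-term≢0 {f = f} (inj₁ refl) x+Σ≢0 =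
    inj₂ (ΣFin≢0⇒term≢0 (λ Σ≡0 → x+Σ≢0 (trans (cong (0ℚ +_) Σ≡0) (ℚP.+-identityˡ 0ℚ))))

  entering-arc : ∀ v → z G y v ≢ 0ℚ →
                 y (src v) ≡ 1ℚ ⊎ Σ (Fin n) λ j → Σ (T (A j v)) λ p → y (mid j v p) ≡ 1ℚ
  entering-arc v z≢0 with one-or-term≢0 (binary (src v)) z≢0
  ... | inj₁ src≡1       = inj₁ src≡1
  ... | inj₂ (j , v≢0)   = inj₂ (j , valMid≢0 j v v≢0)

  leaving-arc : ∀ v → outflow G y v ≢ 0ℚ →
                y (snk v) ≡ 1ℚ ⊎ Σ (Fin n) λ j → Σ (T (A v j)) λ p → y (mid v j p) ≡ 1ℚ
  leaving-arc v out≢0 with one-or-term≢0 (binary (snk v)) out≢0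
  ... | inj₁ snk≡1       = inj₁ snk≡1
  ... | inj₂ (j , v≢0)   = inj₂ (j , valMid≢0 v j v≢0)

  outflow≤1 : ∀ v → outflow G y v ≤ 1ℚ
  outflow≤1 v = subst (_≤ 1ℚ) (flow v) (degree v)

  src≤z : ∀ v → y (src v) ≤ z G y v
  src≤z v = p≤p+q (ΣFin-nonneg (λ j → valMid-nonneg j v))

  arc≤z-head : ∀ {j v} (p : T (A j v)) → y (mid j v p) ≤ z G y v
  arc≤z-head {j} {v} p = begin
    y (mid j v p)                  ≡⟨ sym (valMid-arc j v p) ⟩
    valMid G y j v                 ≤⟨ term≤ΣFin (λ k → valMid-nonneg k v) j ⟩
    ΣFin G (λ k → valMid G y k v)  ≤⟨ q≤p+q (y-nonneg (src v)) ⟩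
    z G y v                        ∎
    where open ℚP.≤-Reasoning

  arc≤outflow-tail : ∀ {v j} (p : T (A v j)) → y (mid v j p) ≤ outflow G y v
  arc≤outflow-tail {v} {j} p = begin
    y (mid v j p)                  ≡⟨ sym (valMid-arc v j p) ⟩
    valMid G y v j                 ≤⟨ term≤ΣFin (λ k → valMid-nonneg v k) j ⟩
    ΣFin G (λ k → valMid G y v k)  ≤⟨ q≤p+q (y-nonneg (snk v)) ⟩
    outflow G y v                  ∎
    where open ℚP.≤-Reasoning

  z≡1-at-src : ∀ {v} → y (src v) ≡ 1ℚ → z G y v ≡ 1ℚ
  z≡1-at-src {v} src≡1 = ℚP.≤-antisym (degree v) (subst (_≤ z G y v) src≡1 (src≤z v))

  z≡1-at-head : ∀ {j v} {p : T (A j v)} → y (mid j v p) ≡ 1ℚ → z G y v ≡ 1ℚ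
  z≡1-at-head {j} {v} {p} a≡1 = ℚP.≤-antisym (degree v) (subst (_≤ z G y v) a≡1 (arc≤z-head p))

  z≡1-at-tail : ∀ {j v} {p : T (A j v)} → y (mid j v p) ≡ 1ℚ → z G y j ≡ 1ℚ
  z≡1-at-tail {j} {v} {p} a≡1 =
    ℚP.≤-antisym (degree j) (subst (1ℚ ≤_) (sym (flow j)) (subst (_≤ outflow G y j) a≡1 (arc≤outflow-tail p)))

  z-binary : ∀ v → z G y v ≡ 0ℚ ⊎ z G y v ≡ 1ℚ
  z-binary v with z G y v ℚP.≟ 0ℚ
  ... | yes z≡0 = inj₁ z≡0
  ... | no z≢0  = inj₂ ([ z≡1-at-src , (λ (_ , _ , a≡1) → z≡1-at-head a≡1) ] (entering-arc v z≢0))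

  successor-unique : ∀ {u w w′} {p : T (A u w)} {p′ : T (A u w′)} →
                     y (mid u w p) ≡ 1ℚ → y (mid u w′ p′) ≡ 1ℚ → w ≡ w′
  successor-unique {u} {w} {w′} {p} {p′} a≡1 a′≡1 with w ≟ᶠ w′
  ... | yes w≡w′ = w≡w′
  ... | no w≢w′  = contradiction two≤1 (p+1≰p 1ℚ)
    where
    open ℚP.≤-Reasoning
    two≤1 : 1ℚ + 1ℚ ≤ 1ℚ
    two≤1 = begin
      1ℚ + 1ℚ                           ≡⟨ sym (cong₂ _+_ (trans (valMid-arc u w p) a≡1)
                                                          (trans (valMid-arc u w′ p′) a′≡1)) ⟩
      valMid G y u w + valMid G y u w′  ≤⟨ pair≤ΣFin (valMid-nonneg u) w≢w′ ⟩
      ΣFin G (valMid G y u)             ≤⟨ q≤p+q (y-nonneg (snk u)) ⟩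
      outflow G y u                     ≤⟨ outflow≤1 u ⟩
      1ℚ                                ∎

  InSupport : ∀ {u v} → Walk A u v → Set
  InSupport w = All (λ a → y a ≡ 1ℚ) (walkArcs G w)

  ++ᵂ-InSupport : ∀ {u v x} {w₁ : Walk A u v} {w₂ : Walk A v x} →
                  InSupport w₁ → InSupport w₂ → InSupport (w₁ ++ᵂ w₂)
  ++ᵂ-InSupport {w₁ = w₁} {w₂} s₁ s₂ = subst (All _) (sym (walkArcs-++ᵂ w₁ w₂)) (AllP.++⁺ s₁ s₂)

  -- The fuel never runs out, by the invariant n ≤ k + |w| and since walks have fewer than n arcs.
  backward : ∀ k {v i} (w : Walk A v i) → InSupport w → n ℕ.≤ k ℕ.+ length (walkArcs G w) →
             z G y v ≡ 1ℚ → Σ (Fin n) λ u → Σ (Walk A u i) λ w′ → InSupport w′ × y (src u) ≡ 1ℚ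
  backward zero    w _ n≤ℓ _ = contradiction n≤ℓ (ℕP.<⇒≱ (walk-length< w))
  backward (suc k) {v} w w-sup n≤ z≡1 with entering-arc v (λ z≡0 → 0≢1 (trans (sym z≡0) z≡1))
  ... | inj₁ src≡1        = v , w , w-sup , src≡1
  ... | inj₂ (j , p , a≡1) =
    backward k (step j p w) (a≡1 ∷ w-sup) (subst (n ℕ.≤_) (sym (ℕP.+-suc k _)) n≤) (z≡1-at-tail a≡1)

  forward : ∀ k {i v} (w : Walk A i v) → InSupport w → n ℕ.≤ k ℕ.+ length (walkArcs G w) →
            z G y v ≡ 1ℚ → Σ (Fin n) λ v′ → Σ (Walk A i v′) λ w′ → InSupport w′ × y (snk v′) ≡ 1ℚ
  forward zero    w _ n≤ℓ _ = contradiction n≤ℓ (ℕP.<⇒≱ (walk-length< w))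
  forward (suc k) {v = v} w w-sup n≤ z≡1
    with leaving-arc v (λ out≡0 → 0≢1 (trans (sym out≡0) (trans (sym (flow v)) z≡1)))
  ... | inj₁ snk≡1        = v , w , w-sup , snk≡1
  ... | inj₂ (j , p , a≡1) =
    forward k (w ++ᵂ step v p (stop j)) (++ᵂ-InSupport w-sup (a≡1 ∷ []))
      (subst (n ℕ.≤_) (trans (sym (ℕP.+-suc k _)) (cong (k ℕ.+_) (sym (length-snoc w p)))) n≤)
      (z≡1-at-head a≡1)

  sumℚ-of-ones : ∀ xs → All (λ a → y a ≡ 1ℚ) xs → sumℚ G (map y xs) ≡ (ℤ.+ length xs) / 1
  sumℚ-of-ones []       []         = refl
  sumℚ-of-ones (a ∷ xs) (a≡1 ∷ xs≡1) =
    trans (cong₂ _+_ a≡1 (sumℚ-of-ones xs xs≡1)) (1+n/1≡[1+n]/1 (length xs))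

  checked? : ∀ a → Dec (Checked G a)
  checked? (src _)     = no λ ()
  checked? (mid i j _) = T? (Ac i j)
  checked? (snk _)     = no λ ()

  saturated-path-feasible : ∀ {u v} (w : Walk A u v) → y (src u) ≡ 1ℚ → InSupport w → y (snk v) ≡ 1ℚ →
                            Feasible G (path u v w)
  saturated-path-feasible {u} {v} w src≡1 w-sup snk≡1 with any? checked? (pathArcs G (path u v w))
  ... | yes feasible  = feasible
  ... | no infeasible =
    contradiction (subst (λ s → s + 1ℚ ≤ ℓ) Σy≡ℓ (infeasib (path u v w) infeasible)) (p+1≰p ℓ)
    where
    ℓ : ℚ
    ℓ = (ℤ.+ length (pathArcs G (path u v w))) / 1
    Σy≡ℓ : sumℚ G (map y (pathArcs G (path u v w))) ≡ ℓ
    Σy≡ℓ = sumℚ-of-ones (pathArcs G (path u v w)) (src≡1 ∷ AllP.++⁺ w-sup (snk≡1 ∷ []))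

  support-walks-nested : ∀ {h v v′} (w : Walk A h v) (w′ : Walk A h v′) → InSupport w → InSupport w′ →
                         v ∈ walkNodes G w′ ⊎ v′ ∈ walkNodes G w
  support-walks-nested (stop _)     w′           _         _           = inj₁ (first∈walkNodes w′)
  support-walks-nested (step _ _ _) (stop _)     _         _           = inj₂ (here refl)
  support-walks-nested (step _ _ w) (step _ _ w′) (a≡1 ∷ s) (a′≡1 ∷ s′) with successor-unique a≡1 a′≡1
  ... | refl = Sum.map there there (support-walks-nested w w′ s s′)

-- Entering arcs of S on saturated paths

module Entry (G : Graph) (S : Subset (Graph.n G)) {y : Arc G → ℚ} (y-int : IntPoint G y) where
  open Graph G
  open Walks G
  open IntegerPoint G y-int

  -- `snk i` has head n̄ ∉ V; the value `i` given to it is never used.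
  head : Arc G → Fin n
  head (src i)     = i
  head (mid _ i _) = i
  head (snk i)     = i

  EntryOf : ∀ (v : Fin n) → List (Arc G) → Set
  EntryOf v as = Σ (Arc G) λ a → a ∈ as × Enters G S a × y a ≡ 1ℚ × Σ (Walk A (head a) v) InSupport

  inner-entry : ∀ {u v} (w : Walk A u v) → InSupport w → u ∉ˢ S → v ∈ˢ S → EntryOf v (walkArcs G w)
  inner-entry (stop _)         _           u∉S v∈S = contradiction v∈S u∉S
  inner-entry (step u {x} p w) (a≡1 ∷ w-sup) u∉S v∈S with x ∈? S
  ... | yes x∈S = mid u x p , here refl , (u∉S , x∈S) , a≡1 , w , w-sup
  ... | no x∉S with inner-entry w w-sup x∉S v∈S
  ...   | a , a∈ , rest = a , there a∈ , rest

  entry : ∀ {u v} (w : Walk A u v) → y (src u) ≡ 1ℚ → InSupport w → v ∈ˢ S → EntryOf v (src u ∷ walkArcs G w)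
  entry {u} w src≡1 w-sup v∈S with u ∈? S
  ... | yes u∈S = src u , here refl , u∈S , src≡1 , w , w-sup
  ... | no u∉S with inner-entry w w-sup u∉S v∈S
  ...   | a , a∈ , rest = a , there a∈ , rest

  record Witness (i : Fin n) : Set where
    field
      arc       : Arc G
      enters    : Enters G S arc
      reaches   : InÀ G i arc
      saturated : y arc ≡ 1ℚ
      onward    : Walk A (head arc) i
      onward-supported : InSupport onward

  witness : ∀ {i} → i ∈ˢ S → z G y i ≡ 1ℚ → Witness i
  witness {i} i∈S z≡1 with backward n (stop i) [] (ℕP.m≤m+n n 0) z≡1 | forward n (stop i) [] (ℕP.m≤m+n n 0) z≡1
  ... | u , w₁ , w₁-sup , src≡1 | v , w₂ , w₂-sup , snk≡1 with entry w₁ src≡1 w₁-sup i∈S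
  ...   | a , a∈ , enters , a≡1 , onward , onward-sup = record
    { arc       = a
    ; enters    = enters
    ; reaches   = u , v , w₁ , w₂ , saturated-path-feasible (w₁ ++ᵂ w₂) src≡1 (++ᵂ-InSupport w₁-sup w₂-sup) snk≡1 , a∈
    ; saturated = a≡1
    ; onward    = onward
    ; onward-supported = onward-sup
    }

  shared-witness⇒common-path :
    ∀ {i j} (wᵢ : Witness i) (wⱼ : Witness j) → Witness.arc wᵢ ≡ Witness.arc wⱼ →
    Σ (Path G) λ p → i ∈ pathNodes G p × j ∈ pathNodes G p
  shared-witness⇒common-path {i} {j} wᵢ wⱼ refl
    with support-walks-nested (Witness.onward wᵢ) (Witness.onward wⱼ)
                              (Witness.onward-supported wᵢ) (Witness.onward-supported wⱼ)
  ... | inj₁ i∈ = path _ j (Witness.onward wⱼ) , i∈ , last∈walkNodes (Witness.onward wⱼ)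
  ... | inj₂ j∈ = path _ i (Witness.onward wᵢ) , last∈walkNodes (Witness.onward wᵢ) , j∈

-- The inequality at integer points

module IntegerBound (G : Graph) (S T : Subset (Graph.n G)) (T⊆S : T ⊆ S) (conflicting : ConflictingSet G T)
                    (L : List (Arc G)) (covers : ∀ a → Enters G S a × InÀT G T a → a ∈ L)
                    {y : Arc G → ℚ} (y-int : IntPoint G y) where
  open Graph G
  open FiniteSums G
  open IntegerPoint G y-int
  open Entry G S y-int

  zT : Fin n → ℚ
  zT i = select (i ∈? T) (z G y i)

  witness-of : ∀ i → zT i ≡ 1ℚ → Witness i
  witness-of i zT≡1 = let i∈T , z≡1 = select≡1 (i ∈? T) zT≡1 in witness (T⊆S i∈T) z≡1

  witness∈L : ∀ i (e : zT i ≡ 1ℚ) → Witness.arc (witness-of i e) ∈ L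
  witness∈L i e = covers _ (Witness.enters wᵢ , i , proj₁ (select≡1 (i ∈? T) e) , Witness.reaches wᵢ)
    where
    wᵢ : Witness i
    wᵢ = witness-of i e

  position : ∀ i → zT i ≡ 1ℚ → Fin (length L)
  position i e = index (witness∈L i e)

  witness-at-position : ∀ i e → Witness.arc (witness-of i e) ≡ lookup L (position i e)
  witness-at-position i e = lookup-index (witness∈L i e)

  position-saturated : ∀ i e → 1ℚ ≤ y (lookup L (position i e))
  position-saturated i e =
    ℚP.≤-reflexive (sym (trans (cong y (sym (witness-at-position i e))) (Witness.saturated (witness-of i e))))

  position-injective : ∀ {i j} e e′ → position i e ≡ position j e′ → i ≡ j
  position-injective {i} {j} e e′ same with i ≟ᶠ j
  ... | yes i≡j = i≡j
  ... | no i≢j  =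
    contradiction (shared-witness⇒common-path (witness-of i e) (witness-of j e′) same-arc)
                  (conflicting i j (proj₁ (select≡1 (i ∈? T) e)) (proj₁ (select≡1 (j ∈? T) e′)) i≢j)
    where
    same-arc : Witness.arc (witness-of i e) ≡ Witness.arc (witness-of j e′)
    same-arc = trans (witness-at-position i e) (trans (cong (lookup L) same) (sym (witness-at-position j e′)))

  integer-bound : ΣFin G zT ≤ sumℚ G (map y L)
  integer-bound = begin
    ΣFin G zT               ≤⟨ ΣFin≤ΣFin-by-injection zT-binary (y-nonneg ∘ lookup L)
                                 position position-saturated position-injective ⟩
    ΣFin G (y ∘ lookup L)   ≡⟨ sym (sumℚ≡ΣFin-lookup y L) ⟩
    sumℚ G (map y L)        ∎
    where
    open ℚP.≤-Reasoning
    zT-binary : ∀ i → zT i ≡ 0ℚ ⊎ zT i ≡ 1ℚ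
    zT-binary i = select-binary (i ∈? T) (z-binary i)

proposition8 : (G : Graph) (S T : Subset (Graph.n G)) → T ⊆ S → ConflictingSet G T →
               (y : Arc G → ℚ) → InP G y →
               (L : List (Arc G)) → Unique L →
               (∀ a → (a ∈ L) ⇔ (Enters G S a × InÀT G T a)) →
               ΣT G T (z G y) ≤ sumℚ G (map y L)
proposition8 G S T T⊆S conflicting y y∈P L _ L≡δ⁻S∩À⁻T = begin
  ΣT G T (z G y)                            ≡⟨ ΣT≡ΣFin-select G T (z G y) ⟩
  ΣFin G (λ i → select (i ∈? T) (z G y i))  ≤⟨ valid-on-P linear-lhs (linear-sumℚ L) on-integer-points y y∈P ⟩
  sumℚ G (map y L)                          ∎
  where
  open ℚP.≤-Reasoning
  open Linearity G
  linear-lhs : Linear (λ y → ΣFin G (λ i → select (i ∈? T) (z G y i)))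
  linear-lhs = linear-ΣFin (λ i → linear-select (i ∈? T) (linear-z i))
  on-integer-points : ∀ y → IntPoint G y → ΣFin G (λ i → select (i ∈? T) (z G y i)) ≤ sumℚ G (map y L)
  on-integer-points y y-int =
    IntegerBound.integer-bound G S T T⊆S conflicting L (Equivalence.from ∘ L≡δ⁻S∩À⁻T) y-int
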